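{- Let $P$ be a finite set (of "properties"), and let $l$ be a lace-map on $P$, i.e. a map assigning to each subset $S \subseteq P$ a subset $l(S) \subseteq P$ such that for all $S, G, S_1, S_2 \subseteq P$: (i) $l(S) \subseteq S$; (ii) if $l(S) \subseteq G \subseteq S$ then $l(G) = l(S)$; (iii) if $l(S_1) = l(S_2)$ then $l(S_1 \cup S_2) = l(S_1)$. A set $L \subseteq P$ with $l(L) = L$ is called a lace, and $\mathcal{L}$ denotes the collection of all laces. For a lace $L$, let $C(L) = \{ p \in P \setminus L : l(L \cup \{p\}) = L \}$ (the set of properties compatible with $L$). Let $X$ be a finite set, where each element $x \in X$ possesses some subset of the properties in $P$, and let $wt : X \to \mathbb{R}$ be any function. For a lace $L$, let $N(L)$ be the sum of $wt(x)$ over those $x \in X$ that have every property in $L$ and have none of the properties in $C(L)$. Let $N_0(X)$ be the sum of $wt(x)$ over those $x \in X$ that have none of the properties in $P$. Then $$N_0(X) = \sum_{L \in \mathcal{L}} (-1)^{|L|} N(L).$$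
   Context: For a lace $L$, the set $C(L)$ satisfies $\{S \subseteq P : l(S) = L\} = \{S : L \subseteq S \subseteq L \cup C(L)\}$; the formula given for $C(L)$ is the paper's explicit description of this set. -}

module Defs where

open import Level using (Level)
open import Data.Nat using (ℕ; zero; suc)
open import Data.Bool using (Bool; true; false; _∧_; not; if_then_else_)
open import Data.Fin using (Fin)
open import Data.Fin.Subset using (Subset; _⊆_; _∪_; ⁅_⁆; _∩_; ⊥; Empty; ∣_∣; outside; inside)
open import Data.Fin.Subset.Properties using (_∈?_; _⊆?_; nonempty?)
open import Data.Vec using (Vec; []; _∷_; tabulate)
open import Data.Vec.Properties using (≡-dec)
import Data.Bool.Properties as BoolP
open import Data.List using (List; []; _∷_; map; _++_; allFin; foldr)
open import Relation.Binary.PropositionalEquality using (_≡_)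
open import Relation.Nullary using (Dec; yes; no; does; ¬_)
open import Relation.Nullary.Decidable using (¬?)
open import Algebra.Bundles using (CommutativeRing)

_≟ₛ_ : ∀ {n} (S T : Subset n) → Dec (S ≡ T)
_≟ₛ_ = ≡-dec BoolP._≟_

record IsLaceMap {n : ℕ} (l : Subset n → Subset n) : Set where
  field
    shrink   : ∀ S → l S ⊆ S
    interval : ∀ S G → l S ⊆ G → G ⊆ S → l G ≡ l S
    union    : ∀ S₁ S₂ → l S₁ ≡ l S₂ → l (S₁ ∪ S₂) ≡ l S₁

IsLace : ∀ {n} (l : Subset n → Subset n) → Subset n → Set
IsLace l L = l L ≡ L

compat : ∀ {n} (l : Subset n → Subset n) → Subset n → Subset n
compat l L = tabulate λ p → does (¬? (p ∈? L)) ∧ does (l (L ∪ ⁅ p ⁆) ≟ₛ L)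

allSubsets : ∀ n → List (Subset n)
allSubsets zero    = [] ∷ []
allSubsets (suc n) = map (outside ∷_) (allSubsets n) ++ map (inside ∷_) (allSubsets n)

module _ {c ℓ : Level} (R : CommutativeRing c ℓ) where
  open CommutativeRing R

  sumL : ∀ {A : Set} → (A → Carrier) → List A → Carrier
  sumL f = foldr (λ a s → f a + s) 0#

  negOnePow : ℕ → Carrier
  negOnePow zero    = 1#
  negOnePow (suc k) = (- 1#) * negOnePow k

  -- X = Fin m, element x has the properties props x ⊆ P
  -- N(L): sum of wt x over x having all of L and none of C(L)
  Nlace : ∀ {n m} (l : Subset n → Subset n) (props : Fin m → Subset n)
          (wt : Fin m → Carrier) → Subset n → Carrier
  Nlace {m = m} l props wt L =
    sumL (λ x → if does (L ⊆? props x) ∧ not (does (nonempty? (compat l L ∩ props x)))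
                then wt x else 0#) (allFin m)

  N₀ : ∀ {n m} (props : Fin m → Subset n) (wt : Fin m → Carrier) → Carrier
  N₀ {m = m} props wt =
    sumL (λ x → if does (nonempty? (props x)) then 0# else wt x) (allFin m)

  laceSum : ∀ {n m} (l : Subset n → Subset n) (props : Fin m → Subset n)
            (wt : Fin m → Carrier) → Carrier
  laceSum {n} l props wt =
    sumL (λ L → if does (l L ≟ₛ L) then negOnePow ∣ L ∣ * Nlace l props wt L else 0#)
         (allSubsets n)

module Submission where

open import Defs
open import Data.Nat using (ℕ; zero; suc)
open import Data.Bool using (Bool; true; false; _∧_; not; if_then_else_)
open import Data.Bool.Properties using (∧-zeroʳ)
open import Data.Fin using (Fin)
open import Data.Fin.Subset
  using (Subset; outside; inside; _∈_; _∉_; _⊆_; _∪_; _∩_; ⁅_⁆; ⊥; Empty; ∣_∣)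
open import Data.Fin.Subset.Properties
  using (_∈?_; _⊆?_; nonempty?; ⊆-refl; ⊆-min; ⊆-antisym; ∉⊥; ∣⊥∣≡0; Empty-unique;
         x∈⁅x⁆; x∈⁅y⁆⇒x≡y; x∈p∪q⁺; x∈p∪q⁻; x∈p∩q⁺; x∈p∩q⁻; p∩q⊆p; p∩q⊆q; q⊆p∪q)
open import Data.List using (List; []; _∷_; map; _++_; filter; allFin)
open import Data.List.Relation.Unary.All using (All; []; _∷_)
open import Data.List.Relation.Unary.All.Properties using (all-filter)
open import Data.List.Relation.Unary.Any using (here; there)
import Data.List.Membership.Propositional as List
open import Data.List.Membership.Propositional.Properties using (∈-allFin; ∈-filter⁺)
open import Data.Product using (_×_; _,_; proj₁; proj₂)
open import Data.Sum using (inj₁; inj₂; [_,_]′)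
open import Data.Vec using ([]; _∷_; tabulate)
open import Data.Vec.Properties using (lookup∘tabulate; []=⇒lookup; lookup⇒[]=)
open import Function using (_∘_; _⇔_; mk⇔; Equivalence)
open import Algebra.Bundles using (CommutativeRing)
open import Relation.Nullary using (Dec; yes; no; does; contradiction)
open import Relation.Nullary.Decidable using (¬?; _×-dec_; dec-true; dec-false; does-⇔)
import Relation.Binary.PropositionalEquality as ≡
open ≡ using (_≡_; cong; cong₂; subst)

open Equivalence using (to; from)

-- Group the subsets S of the property set A of an element by their lace l(S).
-- For a lace L the fibre {S : l(S) = L} is the interval [L, L ∪ C(L)], so the
-- S ⊆ A in it form the interval [L, (L ∪ C(L)) ∩ A]. An alternating sum over an
-- interval vanishes unless the interval is a single point, which here means
-- L ⊆ A and C(L) ∩ A = ∅. Hence Σ_L (-1)^|L| [L ⊆ A, C(L) ∩ A = ∅] equals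
-- Σ_{S ⊆ A} (-1)^|S| = [A = ∅]; weighting by wt and summing over X gives the theorem.

∈-tabulate-does : ∀ {n} {P : Fin n → Set} (P? : ∀ p → Dec (P p)) {p : Fin n} →
                  p ∈ tabulate (does ∘ P?) ⇔ P p
∈-tabulate-does {P = P} P? {p} = mk⇔ sound complete
  where
  sound : p ∈ tabulate (does ∘ P?) → P p
  sound p∈ with P? p | ≡.trans (≡.sym (lookup∘tabulate (does ∘ P?) p)) ([]=⇒lookup p∈)
  ... | yes Pp | _ = Pp
  ... | no _   | ()

  complete : P p → p ∈ tabulate (does ∘ P?)
  complete Pp = lookup⇒[]= p _ (≡.trans (lookup∘tabulate (does ∘ P?) p) (dec-true (P? p) Pp))

⊥≡⇔Empty : ∀ {n} {A : Subset n} → ⊥ ≡ A ⇔ Empty A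
⊥≡⇔Empty = mk⇔ (λ { ≡.refl (_ , x∈⊥) → ∉⊥ x∈⊥ }) (≡.sym ∘ Empty-unique)

⊆-∩⇔ : ∀ {n} {S B A : Subset n} → S ⊆ B ∩ A ⇔ (S ⊆ B × S ⊆ A)
⊆-∩⇔ {S = S} {B} {A} = mk⇔ split join
  where
  split : S ⊆ B ∩ A → S ⊆ B × S ⊆ A
  split S⊆ = p∩q⊆p B A ∘ S⊆ , p∩q⊆q B A ∘ S⊆

  join : S ⊆ B × S ⊆ A → S ⊆ B ∩ A
  join (S⊆B , S⊆A) x∈S = x∈p∩q⁺ (S⊆B x∈S , S⊆A x∈S)

≡-∪-∩⇔ : ∀ {n} {L C A : Subset n} → (∀ {x} → x ∈ C → x ∉ L) →
         L ≡ (L ∪ C) ∩ A ⇔ (L ⊆ A × Empty (C ∩ A))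
≡-∪-∩⇔ {L = L} {C} {A} disjoint = mk⇔ split join
  where
  split : L ≡ (L ∪ C) ∩ A → L ⊆ A × Empty (C ∩ A)
  split eq = (λ x∈L → proj₂ (x∈p∩q⁻ (L ∪ C) A (subst (_ ∈_) eq x∈L)))
           , (λ (x , x∈C∩A) → let (x∈C , x∈A) = x∈p∩q⁻ C A x∈C∩A in
                disjoint x∈C (subst (x ∈_) (≡.sym eq) (x∈p∩q⁺ (x∈p∪q⁺ (inj₂ x∈C) , x∈A))))

  join : L ⊆ A × Empty (C ∩ A) → L ≡ (L ∪ C) ∩ A
  join (L⊆A , C∩A-empty) = ⊆-antisym
    (λ x∈L → x∈p∩q⁺ (x∈p∪q⁺ (inj₁ x∈L) , L⊆A x∈L))
    (λ {x} x∈ → let (x∈L∪C , x∈A) = x∈p∩q⁻ (L ∪ C) A x∈ in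
      [ (λ x∈L → x∈L) , (λ x∈C → contradiction (x , x∈p∩q⁺ (x∈C , x∈A)) C∩A-empty) ]′
        (x∈p∪q⁻ L C x∈L∪C))

module FiniteSums {c ℓ} (R : CommutativeRing c ℓ) where
  open CommutativeRing R
  open import Algebra.Properties.Ring ring using (-1*x≈-x)
  open import Algebra.Properties.CommutativeSemigroup +-commutativeSemigroup using (interchange)
  open import Relation.Binary.Reasoning.Setoid setoid

  ∑ : ∀ {A : Set} → (A → Carrier) → List A → Carrier
  ∑ = sumL R

  syntax ∑ (λ a → e) xs = ∑[ a ∈ xs ] e

  [_]_ : Bool → Carrier → Carrier
  [ b ] x = if b then x else 0#

  sign : ∀ {n} → Subset n → Carrier
  sign S = negOnePow R ∣ S ∣

  []-∧ : ∀ b c x → [ b ∧ c ] x ≡ [ b ] ([ c ] x)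
  []-∧ false c x = ≡.refl
  []-∧ true  c x = ≡.refl

  []-∧false : ∀ b x → [ b ∧ false ] x ≡ 0#
  []-∧false b x = cong ([_] x) (∧-zeroʳ b)

  []-*ˡ : ∀ b k x → [ b ] (k * x) ≈ k * [ b ] x
  []-*ˡ true  k x = refl
  []-*ˡ false k x = sym (zeroʳ k)

  *-[]-comm : ∀ b k x → k * [ b ] x ≈ [ b ] k * x
  *-[]-comm true  k x = refl
  *-[]-comm false k x = trans (zeroʳ k) (sym (zeroˡ x))

  if-then-0#≈[not] : ∀ b x → (if b then 0# else x) ≈ [ not b ] 1# * x
  if-then-0#≈[not] true  x = sym (zeroˡ x)
  if-then-0#≈[not] false x = sym (*-identityˡ x)

  module _ {A : Set} where
    ∑-cong : ∀ {f g : A → Carrier} → (∀ a → f a ≈ g a) → ∀ xs → ∑ f xs ≈ ∑ g xs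
    ∑-cong f≈g []       = refl
    ∑-cong f≈g (x ∷ xs) = +-cong (f≈g x) (∑-cong f≈g xs)

    ∑-zero : ∀ {f : A → Carrier} → (∀ a → f a ≈ 0#) → ∀ xs → ∑ f xs ≈ 0#
    ∑-zero f≈0 []       = refl
    ∑-zero f≈0 (x ∷ xs) = trans (+-cong (f≈0 x) (∑-zero f≈0 xs)) (+-identityʳ 0#)

    ∑-+ : ∀ (f g : A → Carrier) xs → ∑[ a ∈ xs ] (f a + g a) ≈ ∑ f xs + ∑ g xs
    ∑-+ f g []       = sym (+-identityʳ 0#)
    ∑-+ f g (x ∷ xs) = trans (+-cong refl (∑-+ f g xs)) (interchange _ _ _ _)

    *-distribˡ-∑ : ∀ k (f : A → Carrier) xs → k * ∑ f xs ≈ ∑[ a ∈ xs ] (k * f a)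
    *-distribˡ-∑ k f []       = zeroʳ k
    *-distribˡ-∑ k f (x ∷ xs) = trans (distribˡ k _ _) (+-cong refl (*-distribˡ-∑ k f xs))

    *-distribʳ-∑ : ∀ k (f : A → Carrier) xs → ∑ f xs * k ≈ ∑[ a ∈ xs ] (f a * k)
    *-distribʳ-∑ k f []       = zeroˡ k
    *-distribʳ-∑ k f (x ∷ xs) = trans (distribʳ k _ _) (+-cong refl (*-distribʳ-∑ k f xs))

    ∑-++ : ∀ (f : A → Carrier) xs ys → ∑ f (xs ++ ys) ≈ ∑ f xs + ∑ f ys
    ∑-++ f []       ys = sym (+-identityˡ _)
    ∑-++ f (x ∷ xs) ys = trans (+-cong refl (∑-++ f xs ys)) (sym (+-assoc _ _ _))

  ∑-map : ∀ {A B : Set} (f : B → Carrier) (g : A → B) xs → ∑ f (map g xs) ≡ ∑ (f ∘ g) xs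
  ∑-map f g []       = ≡.refl
  ∑-map f g (x ∷ xs) = cong (f (g x) +_) (∑-map f g xs)

  ∑-comm : ∀ {A B : Set} (h : A → B → Carrier) xs ys →
           ∑[ a ∈ xs ] ∑[ b ∈ ys ] h a b ≈ ∑[ b ∈ ys ] ∑[ a ∈ xs ] h a b
  ∑-comm h []       ys = sym (∑-zero (λ _ → refl) ys)
  ∑-comm h (x ∷ xs) ys = trans (+-cong refl (∑-comm h xs ys))
                               (sym (∑-+ (h x) (λ b → ∑[ a ∈ xs ] h a b) ys))

  []-*-∑ : ∀ {A : Set} b k (c : A → Bool) (w : A → Carrier) xs →
           [ b ] (k * ∑[ a ∈ xs ] [ c a ] w a) ≈ ∑[ a ∈ xs ] ([ b ∧ c a ] k * w a)
  []-*-∑ false k c w xs = sym (∑-zero (λ a → zeroˡ (w a)) xs)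
  []-*-∑ true  k c w xs = trans (*-distribˡ-∑ k _ xs) (∑-cong (λ a → *-[]-comm (c a) k (w a)) xs)

  ∑-allSubsets-suc : ∀ n (F : Subset (suc n) → Carrier) →
    ∑ F (allSubsets (suc n)) ≈ ∑[ S ∈ allSubsets n ] F (outside ∷ S) + ∑[ S ∈ allSubsets n ] F (inside ∷ S)
  ∑-allSubsets-suc n F = trans (∑-++ F (map (outside ∷_) (allSubsets n)) (map (inside ∷_) (allSubsets n)))
                               (+-cong (reflexive (∑-map F (outside ∷_) (allSubsets n)))
                                       (reflexive (∑-map F (inside ∷_) (allSubsets n))))

  ∑-allSubsets-≟ : ∀ n (T : Subset n) x → ∑[ S ∈ allSubsets n ] [ does (T ≟ₛ S) ] x ≈ x
  ∑-allSubsets-≟ zero    []            x = +-identityʳ x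
  ∑-allSubsets-≟ (suc n) (outside ∷ T) x = begin
    _                ≈⟨ ∑-allSubsets-suc n _ ⟩
    _ + _            ≈⟨ +-cong (∑-allSubsets-≟ n T x) (∑-zero (λ _ → refl) (allSubsets n)) ⟩
    x + 0#           ≈⟨ +-identityʳ x ⟩
    x                ∎
  ∑-allSubsets-≟ (suc n) (inside ∷ T) x = begin
    _                ≈⟨ ∑-allSubsets-suc n _ ⟩
    _ + _            ≈⟨ +-cong (∑-zero (λ _ → refl) (allSubsets n)) (∑-allSubsets-≟ n T x) ⟩
    0# + x           ≈⟨ +-identityˡ x ⟩
    x                ∎

  ∑-sign-interval : ∀ n (L U : Subset n) →
    ∑[ S ∈ allSubsets n ] [ does (L ⊆? S) ∧ does (S ⊆? U) ] sign S ≈ [ does (L ≟ₛ U) ] sign L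
  ∑-sign-interval zero [] [] = +-identityʳ 1#
  ∑-sign-interval (suc n) (outside ∷ L) (outside ∷ U) = begin
    _      ≈⟨ ∑-allSubsets-suc n _ ⟩
    _ + _  ≈⟨ +-cong (∑-sign-interval n L U)
                     (∑-zero (λ S → reflexive ([]-∧false (does (L ⊆? S)) _)) (allSubsets n)) ⟩
    _ + 0# ≈⟨ +-identityʳ _ ⟩
    _      ∎
  ∑-sign-interval (suc n) (inside ∷ L) (inside ∷ U) = begin
    _  ≈⟨ ∑-allSubsets-suc n _ ⟩
    ∑ (λ _ → 0#) (allSubsets n) + _
       ≈⟨ +-cong (∑-zero (λ _ → refl) (allSubsets n)) refl ⟩
    0# + _
       ≈⟨ +-identityˡ _ ⟩
    ∑[ S ∈ allSubsets n ] [ does (L ⊆? S) ∧ does (S ⊆? U) ] (- 1# * sign S)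
       ≈⟨ ∑-cong (λ S → []-*ˡ _ (- 1#) (sign S)) (allSubsets n) ⟩
    ∑[ S ∈ allSubsets n ] (- 1# * [ does (L ⊆? S) ∧ does (S ⊆? U) ] sign S)
       ≈⟨ sym (*-distribˡ-∑ (- 1#) _ (allSubsets n)) ⟩
    - 1# * ∑[ S ∈ allSubsets n ] [ does (L ⊆? S) ∧ does (S ⊆? U) ] sign S
       ≈⟨ *-cong refl (∑-sign-interval n L U) ⟩
    - 1# * [ does (L ≟ₛ U) ] sign L
       ≈⟨ sym ([]-*ˡ _ (- 1#) (sign L)) ⟩
    _  ∎
  ∑-sign-interval (suc n) (outside ∷ L) (inside ∷ U) = begin
    _              ≈⟨ ∑-allSubsets-suc n _ ⟩
    X + ∑[ S ∈ allSubsets n ] [ does (L ⊆? S) ∧ does (S ⊆? U) ] (- 1# * sign S)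
                   ≈⟨ +-cong refl (∑-cong (λ S → []-*ˡ _ (- 1#) (sign S)) (allSubsets n)) ⟩
    X + ∑[ S ∈ allSubsets n ] (- 1# * [ does (L ⊆? S) ∧ does (S ⊆? U) ] sign S)
                   ≈⟨ +-cong refl (sym (*-distribˡ-∑ (- 1#) _ (allSubsets n))) ⟩
    X + - 1# * X   ≈⟨ +-cong refl (-1*x≈-x X) ⟩
    X - X          ≈⟨ -‿inverseʳ X ⟩
    0#             ∎
    where X = ∑[ S ∈ allSubsets n ] [ does (L ⊆? S) ∧ does (S ⊆? U) ] sign S
  ∑-sign-interval (suc n) (inside ∷ L) (outside ∷ U) = begin
    _      ≈⟨ ∑-allSubsets-suc n _ ⟩
    _ + _  ≈⟨ +-cong (∑-zero (λ _ → refl) (allSubsets n))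
                     (∑-zero (λ S → reflexive ([]-∧false (does (L ⊆? S)) _)) (allSubsets n)) ⟩
    0# + 0# ≈⟨ +-identityʳ 0# ⟩
    0#     ∎

  ∑-sign-⊆ : ∀ {n} (A : Subset n) →
    ∑[ S ∈ allSubsets n ] [ does (S ⊆? A) ] sign S ≈ [ not (does (nonempty? A)) ] 1#
  ∑-sign-⊆ {n} A = begin
    ∑[ S ∈ allSubsets n ] [ does (S ⊆? A) ] sign S
      ≈⟨ ∑-cong (λ S → reflexive (cong (λ b → [ b ∧ does (S ⊆? A) ] sign S) (≡.sym (dec-true (⊥ ⊆? S) (⊆-min S)))))
                (allSubsets n) ⟩
    ∑[ S ∈ allSubsets n ] [ does (⊥ ⊆? S) ∧ does (S ⊆? A) ] sign S
      ≈⟨ ∑-sign-interval n ⊥ A ⟩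
    [ does (⊥ ≟ₛ A) ] sign (⊥ {n})
      ≡⟨ cong₂ [_]_ (does-⇔ ⊥≡⇔Empty (⊥ ≟ₛ A) (¬? (nonempty? A))) (cong (negOnePow R) (∣⊥∣≡0 n)) ⟩
    [ not (does (nonempty? A)) ] 1# ∎

module LaceMap {n : ℕ} {l : Subset n → Subset n} (isLaceMap : IsLaceMap l) where
  open IsLaceMap isLaceMap

  ∈-compat : ∀ {L p} → p ∈ compat l L ⇔ (p ∉ L × l (L ∪ ⁅ p ⁆) ≡ L)
  ∈-compat {L} = ∈-tabulate-does (λ p → ¬? (p ∈? L) ×-dec (l (L ∪ ⁅ p ⁆) ≟ₛ L))

  compat-disjoint : ∀ {L x} → x ∈ compat l L → x ∉ L
  compat-disjoint x∈C = proj₁ (to ∈-compat x∈C)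

  l-idempotent : ∀ S → l (l S) ≡ l S
  l-idempotent S = interval S (l S) ⊆-refl (shrink S)

  fibre-∪ : ∀ {S₁ S₂ L} → l S₁ ≡ L → l S₂ ≡ L → l (S₁ ∪ S₂) ≡ L
  fibre-∪ {S₁} {S₂} e₁ e₂ = ≡.trans (union S₁ S₂ (≡.trans e₁ (≡.sym e₂))) e₁

  module _ {L : Subset n} (lace : IsLace l L) where
    saturate : List (Fin n) → Subset n
    saturate []       = L
    saturate (p ∷ ps) = (L ∪ ⁅ p ⁆) ∪ saturate ps

    l-saturate : ∀ {ps} → All (_∈ compat l L) ps → l (saturate ps) ≡ L
    l-saturate []           = lace
    l-saturate (p∈C ∷ ps∈C) = fibre-∪ (proj₂ (to ∈-compat p∈C)) (l-saturate ps∈C)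

    ⊆-saturate : ∀ ps → L ⊆ saturate ps
    ⊆-saturate []       x∈L = x∈L
    ⊆-saturate (p ∷ ps) x∈L = q⊆p∪q _ _ (⊆-saturate ps x∈L)

    ∈-saturate : ∀ {x ps} → x List.∈ ps → x ∈ saturate ps
    ∈-saturate (here ≡.refl) = x∈p∪q⁺ (inj₁ (x∈p∪q⁺ (inj₂ (x∈⁅x⁆ _))))
    ∈-saturate (there x∈ps)  = q⊆p∪q _ _ (∈-saturate x∈ps)

    -- Any S between L and L ∪ C(L) lies below the union of all L ∪ {p}, p ∈ C(L),
    -- which is in the fibre of L by the union axiom; the interval axiom does the rest.
    fibre⇔interval : ∀ S → l S ≡ L ⇔ (L ⊆ S × S ⊆ L ∪ compat l L)
    fibre⇔interval S = mk⇔ into onto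
      where
      into : l S ≡ L → L ⊆ S × S ⊆ L ∪ compat l L
      into lS≡L = L⊆S , S⊆L∪C
        where
        L⊆S : L ⊆ S
        L⊆S = subst (_⊆ S) lS≡L (shrink S)

        S⊆L∪C : S ⊆ L ∪ compat l L
        S⊆L∪C {x} x∈S with x ∈? L
        ... | yes x∈L = x∈p∪q⁺ (inj₁ x∈L)
        ... | no  x∉L = x∈p∪q⁺ (inj₂ (from ∈-compat (x∉L , ≡.trans (interval S (L ∪ ⁅ x ⁆) lS⊆ ⊆S) lS≡L)))
          where
          lS⊆ : l S ⊆ L ∪ ⁅ x ⁆
          lS⊆ y∈lS = x∈p∪q⁺ (inj₁ (subst (_ ∈_) lS≡L y∈lS))
          ⊆S : L ∪ ⁅ x ⁆ ⊆ S
          ⊆S y∈ with x∈p∪q⁻ L ⁅ x ⁆ y∈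
          ... | inj₁ y∈L = L⊆S y∈L
          ... | inj₂ y∈x = subst (_∈ S) (≡.sym (x∈⁅y⁆⇒x≡y x y∈x)) x∈S

      onto : L ⊆ S × S ⊆ L ∪ compat l L → l S ≡ L
      onto (L⊆S , S⊆L∪C) = ≡.trans (interval G S lG⊆S S⊆G) lG≡L
        where
        candidates = filter (_∈? compat l L) (allFin n)
        G = saturate candidates
        lG≡L : l G ≡ L
        lG≡L = l-saturate (all-filter (_∈? compat l L) (allFin n))
        lG⊆S : l G ⊆ S
        lG⊆S = subst (_⊆ S) (≡.sym lG≡L) L⊆S
        S⊆G : S ⊆ G
        S⊆G {x} x∈S with x∈p∪q⁻ L (compat l L) (S⊆L∪C x∈S)
        ... | inj₁ x∈L = ⊆-saturate candidates x∈L
        ... | inj₂ x∈C = ∈-saturate (∈-filter⁺ (_∈? compat l L) (∈-allFin x) x∈C)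

    fibre-⊆⇔interval : ∀ S A → (l S ≡ L × S ⊆ A) ⇔ (L ⊆ S × S ⊆ (L ∪ compat l L) ∩ A)
    fibre-⊆⇔interval S A = mk⇔
      (λ (lS≡L , S⊆A) → let (L⊆S , S⊆L∪C) = to (fibre⇔interval S) lS≡L in
        L⊆S , from ⊆-∩⇔ (S⊆L∪C , S⊆A))
      (λ (L⊆S , S⊆) → let (S⊆L∪C , S⊆A) = to ⊆-∩⇔ S⊆ in
        from (fibre⇔interval S) (L⊆S , S⊆L∪C) , S⊆A)

module LaceSums {c ℓ} (R : CommutativeRing c ℓ) {n : ℕ} {l : Subset n → Subset n}
                (isLaceMap : IsLaceMap l) where
  open CommutativeRing R
  open FiniteSums R
  open LaceMap isLaceMap
  open import Relation.Binary.Reasoning.Setoid setoid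

  counted : Subset n → Subset n → Bool
  counted L A = does (L ⊆? A) ∧ not (does (nonempty? (compat l L ∩ A)))

  ∑-sign-fibre : ∀ A L →
    ∑[ S ∈ allSubsets n ] [ does (l S ≟ₛ L) ∧ does (S ⊆? A) ] sign S ≈ [ does (l L ≟ₛ L) ∧ counted L A ] sign L
  ∑-sign-fibre A L with l L ≟ₛ L
  ... | no ¬lace = ∑-zero outside-image (allSubsets n)
    where
    outside-image : ∀ S → [ does (l S ≟ₛ L) ∧ does (S ⊆? A) ] sign S ≈ 0#
    outside-image S rewrite dec-false (l S ≟ₛ L) (λ { ≡.refl → ¬lace (l-idempotent S) }) = refl
  ... | yes lace = begin
    ∑[ S ∈ allSubsets n ] [ does (l S ≟ₛ L) ∧ does (S ⊆? A) ] sign S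
      ≈⟨ ∑-cong (λ S → reflexive (cong ([_] sign S) (fibre-as-interval S))) (allSubsets n) ⟩
    ∑[ S ∈ allSubsets n ] [ does (L ⊆? S) ∧ does (S ⊆? U) ] sign S
      ≈⟨ ∑-sign-interval n L U ⟩
    [ does (L ≟ₛ U) ] sign L
      ≡⟨ cong ([_] sign L) interval-is-point ⟩
    [ counted L A ] sign L ∎
    where
    U = (L ∪ compat l L) ∩ A

    fibre-as-interval : ∀ S → does (l S ≟ₛ L) ∧ does (S ⊆? A) ≡ does (L ⊆? S) ∧ does (S ⊆? U)
    fibre-as-interval S =
      does-⇔ (fibre-⊆⇔interval lace S A) ((l S ≟ₛ L) ×-dec (S ⊆? A)) ((L ⊆? S) ×-dec (S ⊆? U))

    interval-is-point : does (L ≟ₛ U) ≡ counted L A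
    interval-is-point =
      does-⇔ (≡-∪-∩⇔ compat-disjoint) (L ≟ₛ U) ((L ⊆? A) ×-dec ¬? (nonempty? (compat l L ∩ A)))

  ∑-sign-laces : ∀ A →
    ∑[ L ∈ allSubsets n ] [ does (l L ≟ₛ L) ∧ counted L A ] sign L ≈ [ not (does (nonempty? A)) ] 1#
  ∑-sign-laces A = begin
    ∑[ L ∈ allSubsets n ] [ does (l L ≟ₛ L) ∧ counted L A ] sign L
      ≈⟨ ∑-cong (λ L → sym (∑-sign-fibre A L)) (allSubsets n) ⟩
    ∑[ L ∈ allSubsets n ] ∑[ S ∈ allSubsets n ] [ does (l S ≟ₛ L) ∧ does (S ⊆? A) ] sign S
      ≈⟨ ∑-comm _ (allSubsets n) (allSubsets n) ⟩
    ∑[ S ∈ allSubsets n ] ∑[ L ∈ allSubsets n ] [ does (l S ≟ₛ L) ∧ does (S ⊆? A) ] sign S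
      ≈⟨ ∑-cong (λ S → ∑-cong (λ L → reflexive ([]-∧ (does (l S ≟ₛ L)) _ _)) (allSubsets n)) (allSubsets n) ⟩
    ∑[ S ∈ allSubsets n ] ∑[ L ∈ allSubsets n ] [ does (l S ≟ₛ L) ] ([ does (S ⊆? A) ] sign S)
      ≈⟨ ∑-cong (λ S → ∑-allSubsets-≟ n (l S) _) (allSubsets n) ⟩
    ∑[ S ∈ allSubsets n ] [ does (S ⊆? A) ] sign S
      ≈⟨ ∑-sign-⊆ A ⟩
    [ not (does (nonempty? A)) ] 1# ∎

  laceSum-by-element : ∀ {m} (props : Fin m → Subset n) (wt : Fin m → Carrier) →
    laceSum R l props wt
      ≈ ∑[ x ∈ allFin m ] ((∑[ L ∈ allSubsets n ] [ does (l L ≟ₛ L) ∧ counted L (props x) ] sign L) * wt x)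
  laceSum-by-element {m} props wt = begin
    laceSum R l props wt
      ≈⟨ ∑-cong (λ L → []-*-∑ (does (l L ≟ₛ L)) (sign L) (counted L ∘ props) wt (allFin m)) (allSubsets n) ⟩
    ∑[ L ∈ allSubsets n ] ∑[ x ∈ allFin m ] ([ does (l L ≟ₛ L) ∧ counted L (props x) ] sign L * wt x)
      ≈⟨ ∑-comm _ (allSubsets n) (allFin m) ⟩
    ∑[ x ∈ allFin m ] ∑[ L ∈ allSubsets n ] ([ does (l L ≟ₛ L) ∧ counted L (props x) ] sign L * wt x)
      ≈⟨ ∑-cong (λ x → sym (*-distribʳ-∑ (wt x) _ (allSubsets n))) (allFin m) ⟩
    ∑[ x ∈ allFin m ] ((∑[ L ∈ allSubsets n ] [ does (l L ≟ₛ L) ∧ counted L (props x) ] sign L) * wt x) ∎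

mainTheorem1 : ∀ {c ℓ} (R : CommutativeRing c ℓ) (n m : ℕ)
    (l : Subset n → Subset n) → IsLaceMap l →
    (props : Fin m → Subset n) (wt : Fin m → CommutativeRing.Carrier R) →
    CommutativeRing._≈_ R (N₀ R props wt) (laceSum R l props wt)
mainTheorem1 R n m l isLaceMap props wt = begin
  N₀ R props wt
    ≈⟨ ∑-cong (λ x → if-then-0#≈[not] (does (nonempty? (props x))) (wt x)) (allFin m) ⟩
  ∑[ x ∈ allFin m ] ([ not (does (nonempty? (props x))) ] 1# * wt x)
    ≈⟨ ∑-cong (λ x → *-congʳ (sym (∑-sign-laces (props x)))) (allFin m) ⟩
  ∑[ x ∈ allFin m ] ((∑[ L ∈ allSubsets n ] [ does (l L ≟ₛ L) ∧ counted L (props x) ] sign L) * wt x)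
    ≈⟨ sym (laceSum-by-element props wt) ⟩
  laceSum R l props wt ∎
  where
  open CommutativeRing R
  open FiniteSums R
  open LaceSums R isLaceMap
  open import Relation.Binary.Reasoning.Setoid setoid
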